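{- For every integer $k\geq 1$ there is a constant $C>0$ (which may depend on $k$) such that for all integers $N>k$, \[ r(1+2^k,N)\ \ge\ N\exp\!\big(-C (\log N )^{1/(k+1)}\big). \]
   Context: For integers $\ell\ge 1$ and $N\ge 1$, $r(\ell,N)$ denotes the maximal cardinality of a subset $A\subseteq\{1,2,\ldots,N\}$ which does not contain an arithmetic progression of length $\ell$, i.e. $A$ contains no set of the form $\{x+jy : 0\le j<\ell\}$ with $x,y$ integers and $y\neq 0$. -}

module Defs where

open import Data.Nat using (ℕ; suc; _<_)
open import Data.Integer using (ℤ; +_; _+_; _*_)
open import Data.Fin using (Fin; toℕ)
open import Data.Fin.Subset using (Subset; _∈_)
open import Data.Product using (Σ; ∃; _×_)
open import Relation.Binary.PropositionalEquality using (_≡_; _≢_)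
open import Relation.Nullary using (¬_)

-- A subset A ⊆ {1,…,N} is encoded as A : Subset N, where index i : Fin N
-- represents the integer i+1.

_∈[1,N]_ : {N : ℕ} → ℤ → Subset N → Set
_∈[1,N]_ {N} z A = ∃ λ (i : Fin N) → (+ suc (toℕ i) ≡ z) × (i ∈ A)

ContainsAP : {N : ℕ} → ℕ → Subset N → Set
ContainsAP ℓ A =
  ∃ λ (x : ℤ) → ∃ λ (y : ℤ) →
    (y ≢ + 0) × ((j : ℕ) → j < ℓ → (x + (+ j) * y) ∈[1,N] A)

APFree : {N : ℕ} → ℕ → Subset N → Set
APFree ℓ A = ¬ ContainsAP ℓ A

{-# OPTIONS --safe #-}
-- A point v of [0, d)ⁿ is read as the base-B number ∑ vₖ Bᵏ with
-- B > 4d, so that along an arithmetic progression of length L + 1 no carries occur and the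
-- digit vectors trace a non-constant curve of degree 1.  Along a polynomial curve of degree D
-- the squared norm has degree 2D; at each level we require ‖v‖² (shifted by a radius) to have
-- small base-B′ digits forming a vector of the next level, so the degree doubles per level.
-- After k − 1 levels the final sphere ‖w‖² = r would make a non-constant curve of degree
-- 2ᵏ⁻¹ have constant squared norm, although its leading coefficient in degree 2ᵏ ≤ L is a
-- positive sum of squares.  Pigeonholing the radius at each level keeps a 2^−O(n) fraction of
-- the points, and n ≈ (log N)^(1/(k+1)), d ≈ 2^(log N / n) give the bound.
module Submission where

open import Defs
open import Data.Nat as ℕ using (ℕ; zero; suc; _≤_; _<_; z≤n; s≤s; _^_)
import Data.Nat.Properties as ℕ
import Data.Nat.Tactic.RingSolver as ℕ-Solver
open import Data.Fin using (Fin; zero; suc; toℕ)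
import Data.Fin.Properties as Fin
open import Data.Product using (Σ; ∃; _×_; _,_; proj₁; proj₂; uncurry)
open import Data.Sum using (_⊎_; inj₁; inj₂)
open import Data.Unit using (⊤; tt)
open import Data.Empty using (⊥; ⊥-elim)
open import Data.Bool using (true; false)
open import Relation.Binary.PropositionalEquality
  using (_≡_; _≢_; refl; sym; trans; cong; cong₂; subst; subst₂; module ≡-Reasoning)
open import Relation.Nullary using (¬_; yes; no; Dec; does; ¬?)

module FiniteDifferences where
  open import Data.Integer using (ℤ; +_; -[1+_]; _+_; _-_; _*_; ∣_∣; _≟_)
  import Data.Integer.Properties as ℤ
  open import Data.Integer.Tactic.RingSolver using (solve-∀)
  open import Algebra.Properties.CommutativeMonoid.Sum ℤ.+-0-commutativeMonoid
    using (sum; sum-cong-≗; sum-replicate-zero)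

  Seq : Set
  Seq = ℕ → ℤ

  Δ : Seq → Seq
  Δ s j = s (suc j) - s j

  Δ^ : ℕ → Seq → Seq
  Δ^ zero    s = s
  Δ^ (suc D) s = Δ^ D (Δ s)

  -- ΔConst D L s c: the D-th difference of s is constantly c wherever it is
  -- determined by the values of s on [0, L] (a vacuous condition when D > L).
  ΔConst : ℕ → ℕ → Seq → ℤ → Set
  ΔConst zero    L       s c = ∀ j → j ≤ L → s j ≡ c
  ΔConst (suc D) zero    s c = ⊤
  ΔConst (suc D) (suc L) s c = ΔConst D L (Δ s) c

  Deg≤ : ℕ → ℕ → Seq → Set
  Deg≤ D L s = ΔConst (suc D) L s (+ 0)

  ConstantOn : ℕ → Seq → Set
  ConstantOn L s = ∀ j → j ≤ L → s j ≡ s 0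

  Nonconstant : ∀ {n} → ℕ → (Fin n → Seq) → Set
  Nonconstant L s = ¬ (∀ i → ConstantOn L (s i))

  ΔConst-cong : ∀ D L (s s′ : Seq) {c} → (∀ j → j ≤ L → s j ≡ s′ j) →
                ΔConst D L s c → ΔConst D L s′ c
  ΔConst-cong zero    L       s s′ s≡s′ q j j≤L = trans (sym (s≡s′ j j≤L)) (q j j≤L)
  ΔConst-cong (suc D) zero    s s′ s≡s′ q = tt
  ΔConst-cong (suc D) (suc L) s s′ s≡s′ q = ΔConst-cong D L (Δ s) (Δ s′) Δs≡Δs′ q
    where
    Δs≡Δs′ : ∀ j → j ≤ L → Δ s j ≡ Δ s′ j
    Δs≡Δs′ j j≤L = cong₂ _-_ (s≡s′ (suc j) (s≤s j≤L)) (s≡s′ j (ℕ.m≤n⇒m≤1+n j≤L))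

  ΔConst-restrict : ∀ D L s {c} → ΔConst D (suc L) s c → ΔConst D L s c
  ΔConst-restrict zero    L       s q j j≤L = q j (ℕ.m≤n⇒m≤1+n j≤L)
  ΔConst-restrict (suc D) zero    s q = tt
  ΔConst-restrict (suc D) (suc L) s q = ΔConst-restrict D L (Δ s) q

  ΔConst-shift : ∀ D L s {c} → ΔConst D (suc L) s c → ΔConst D L (λ j → s (suc j)) c
  ΔConst-shift zero    L       s q j j≤L = q (suc j) (s≤s j≤L)
  ΔConst-shift (suc D) zero    s q = tt
  ΔConst-shift (suc D) (suc L) s q = ΔConst-shift D L (Δ s) q

  ΔConst-0 : ∀ D L → ΔConst D L (λ _ → + 0) (+ 0)
  ΔConst-0 zero    L       j _ = refl
  ΔConst-0 (suc D) zero    = tt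
  ΔConst-0 (suc D) (suc L) = ΔConst-0 D L

  ΔConst-+ : ∀ D L f g {α β} → ΔConst D L f α → ΔConst D L g β →
             ΔConst D L (λ j → f j + g j) (α + β)
  ΔConst-+ zero    L       f g qf qg j j≤L = cong₂ _+_ (qf j j≤L) (qg j j≤L)
  ΔConst-+ (suc D) zero    f g qf qg = tt
  ΔConst-+ (suc D) (suc L) f g qf qg =
    ΔConst-cong D L _ _ (λ j _ → Δ-+ (f (suc j)) (f j) (g (suc j)) (g j))
      (ΔConst-+ D L (Δ f) (Δ g) qf qg)
    where
    Δ-+ : ∀ a b c d → (a - b) + (c - d) ≡ (a + c) - (b + d)
    Δ-+ = solve-∀

  ΔConst-*ˡ : ∀ D L f {α} a → ΔConst D L f α → ΔConst D L (λ j → a * f j) (a * α)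
  ΔConst-*ˡ zero    L       f a qf j j≤L = cong (a *_) (qf j j≤L)
  ΔConst-*ˡ (suc D) zero    f a qf = tt
  ΔConst-*ˡ (suc D) (suc L) f a qf =
    ΔConst-cong D L _ _ (λ j _ → *-distribˡ-- a (f (suc j)) (f j)) (ΔConst-*ˡ D L (Δ f) a qf)
    where
    *-distribˡ-- : ∀ a b c → a * (b - c) ≡ a * b - a * c
    *-distribˡ-- = solve-∀

  -- pascal a b is the binomial coefficient (a + b choose a), the constant in Leibniz's rule.
  pascal : ℕ → ℕ → ℕ
  pascal zero    b       = 1
  pascal (suc a) zero    = 1
  pascal (suc a) (suc b) = pascal a (suc b) ℕ.+ pascal (suc a) b

  pascal-pos : ∀ a b → 1 ≤ pascal a b
  pascal-pos zero    b       = s≤s z≤n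
  pascal-pos (suc a) zero    = s≤s z≤n
  pascal-pos (suc a) (suc b) = ℕ.≤-trans (pascal-pos a (suc b)) (ℕ.m≤m+n _ _)

  ΔConst-* : ∀ L a b f g {α β} → ΔConst a L f α → ΔConst b L g β →
             ΔConst (a ℕ.+ b) L (λ j → f j * g j) (+ pascal a b * α * β)
  ΔConst-* L zero zero f g {α} {β} qf qg j j≤L =
    trans (cong₂ _*_ (qf j j≤L) (qg j j≤L)) (cong (_* β) (sym (ℤ.*-identityˡ α)))
  ΔConst-* L zero (suc b) f g {α} {β} qf qg =
    ΔConst-cong (suc b) L _ _ (λ j j≤L → cong (_* g j) (sym (qf j j≤L)))
      (subst (ΔConst (suc b) L _) (insert-1 α β) (ΔConst-*ˡ (suc b) L g α qg))
    where
    insert-1 : ∀ α β → α * β ≡ + 1 * α * β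
    insert-1 = solve-∀
  ΔConst-* L (suc a) zero f g {α} {β} qf qg =
    ΔConst-cong (suc a ℕ.+ 0) L _ _ (λ j j≤L → trans (cong (_* f j) (sym (qg j j≤L))) (ℤ.*-comm (g j) (f j)))
      (subst₂ (λ D c → ΔConst D L (λ j → β * f j) c) (sym (ℕ.+-identityʳ (suc a))) (insert-1 α β)
        (ΔConst-*ˡ (suc a) L f β qf))
    where
    insert-1 : ∀ α β → β * α ≡ + 1 * α * β
    insert-1 = solve-∀
  ΔConst-* zero    (suc a) (suc b) f g qf qg = tt
  ΔConst-* (suc L) (suc a) (suc b) f g {α} {β} qf qg =
    ΔConst-cong (a ℕ.+ suc b) L _ _ (λ j _ → leibniz (f (suc j)) (f j) (g (suc j)) (g j))
      (subst (ΔConst (a ℕ.+ suc b) L _) (pascal-sum (pascal a (suc b)) (pascal (suc a) b))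
        (ΔConst-+ (a ℕ.+ suc b) L _ _ Δf·g′ f·Δg′))
    where
    leibniz : ∀ f₁ f₀ g₁ g₀ → (f₁ - f₀) * g₁ + f₀ * (g₁ - g₀) ≡ f₁ * g₁ - f₀ * g₀
    leibniz = solve-∀
    pascal-sum : ∀ m n → + m * α * β + + n * α * β ≡ + (m ℕ.+ n) * α * β
    pascal-sum m n rewrite ℤ.pos-+ m n = *-distribʳ-+ (+ m) (+ n) α β
      where
      *-distribʳ-+ : ∀ x y α β → x * α * β + y * α * β ≡ (x + y) * α * β
      *-distribʳ-+ = solve-∀
    γ = + pascal (suc a) b * α * β
    Δf·g′ : ΔConst (a ℕ.+ suc b) L (λ j → Δ f j * g (suc j)) (+ pascal a (suc b) * α * β)
    Δf·g′ = ΔConst-* L a (suc b) (Δ f) (λ j → g (suc j)) qf (ΔConst-shift (suc b) L g qg)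
    f·Δg : ΔConst (suc a ℕ.+ b) L (λ j → f j * Δ g j) γ
    f·Δg = ΔConst-* L (suc a) b f (Δ g) (ΔConst-restrict (suc a) L f qf) qg
    f·Δg′ : ΔConst (a ℕ.+ suc b) L (λ j → f j * Δ g j) γ
    f·Δg′ = subst (λ D → ΔConst D L (λ j → f j * Δ g j) γ) (sym (ℕ.+-suc a b)) f·Δg

  ΔConst-∑ : ∀ {n} D L (s : Fin n → Seq) (c : Fin n → ℤ) → (∀ i → ΔConst D L (s i) (c i)) →
             ΔConst D L (λ j → sum (λ i → s i j)) (sum c)
  ΔConst-∑ {zero}  D L s c q = ΔConst-0 D L
  ΔConst-∑ {suc n} D L s c q =
    ΔConst-+ D L (s zero) _ (q zero) (ΔConst-∑ D L (λ i → s (suc i)) (λ i → c (suc i)) (λ i → q (suc i)))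

  constant⇒Deg≤ : ∀ D L s → ConstantOn L s → Deg≤ D L s
  constant⇒Deg≤ D zero    s const = tt
  constant⇒Deg≤ D (suc L) s const =
    ΔConst-cong D L (λ _ → + 0) (Δ s) (λ j j≤L → sym (Δs≡0 j j≤L)) (ΔConst-0 D L)
    where
    Δs≡0 : ∀ j → j ≤ L → Δ s j ≡ + 0
    Δs≡0 j j≤L = ℤ.i≡j⇒i-j≡0 (trans (const (suc j) (s≤s j≤L)) (sym (const j (ℕ.m≤n⇒m≤1+n j≤L))))

  Deg≤0⇒constant : ∀ L s → Deg≤ 0 L s → ConstantOn L s
  Deg≤0⇒constant zero    s q zero    z≤n       = refl
  Deg≤0⇒constant (suc L) s q zero    j≤L       = refl
  Deg≤0⇒constant (suc L) s q (suc j) (s≤s j≤L) =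
    trans (ℤ.i-j≡0⇒i≡j _ _ (q j j≤L)) (Deg≤0⇒constant (suc L) s q j (ℕ.m≤n⇒m≤1+n j≤L))

  Deg≤⇒ΔConst-Δ^ : ∀ D L s → D ≤ L → Deg≤ D L s → ΔConst D L s (Δ^ D s 0)
  Deg≤⇒ΔConst-Δ^ zero    L       s _         q = Deg≤0⇒constant L s q
  Deg≤⇒ΔConst-Δ^ (suc D) (suc L) s (s≤s D≤L) q = Deg≤⇒ΔConst-Δ^ D L (Δ s) D≤L q

  ΔConst-unique : ∀ D L s {c c′} → D ≤ L → ΔConst D L s c → ΔConst D L s c′ → c ≡ c′
  ΔConst-unique zero    L       s _         q q′ = trans (sym (q 0 z≤n)) (q′ 0 z≤n)
  ΔConst-unique (suc D) (suc L) s (s≤s D≤L) q q′ = ΔConst-unique D L (Δ s) D≤L q q′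

  exact-degree : ∀ {n} D L (s : Fin n → Seq) → D ≤ L → (∀ i → Deg≤ D L (s i)) → Nonconstant L s →
                 ∃ λ e → 1 ≤ e × e ≤ D × ∃ λ (c : Fin n → ℤ) →
                   (∀ i → ΔConst e L (s i) (c i)) × ∃ λ i → c i ≢ + 0
  exact-degree zero L s _ q nonconst = ⊥-elim (nonconst (λ i → Deg≤0⇒constant L (s i) (q i)))
  exact-degree {n} (suc D) L s D<L q nonconst with Fin.all? (λ i → Δ^ (suc D) (s i) 0 ≟ + 0)
  ... | no ¬all0 =
    let i , ci≢0 = Fin.¬∀⟶∃¬ n _ (λ i → Δ^ (suc D) (s i) 0 ≟ + 0) ¬all0
    in suc D , s≤s z≤n , ℕ.≤-refl , (λ i → Δ^ (suc D) (s i) 0) ,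
       (λ i → Deg≤⇒ΔConst-Δ^ (suc D) L (s i) D<L (q i)) , i , ci≢0
  ... | yes all0 =
    let e , 1≤e , e≤D , rest = exact-degree D L s (ℕ.<⇒≤ D<L) degD nonconst
    in e , 1≤e , ℕ.m≤n⇒m≤1+n e≤D , rest
    where
    degD : ∀ i → Deg≤ D L (s i)
    degD i = subst (ΔConst (suc D) L (s i)) (all0 i) (Deg≤⇒ΔConst-Δ^ (suc D) L (s i) D<L (q i))

  normSq : ∀ {n} → (Fin n → Seq) → Seq
  normSq {n} s j = sum (λ i → s i j * s i j)

  normSq-Deg≤ : ∀ {n} D L (s : Fin n → Seq) → D ≤ L → (∀ i → Deg≤ D L (s i)) →
                Deg≤ (D ℕ.+ D) L (normSq s)
  normSq-Deg≤ {n} D L s D≤L q =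
    subst (ΔConst (suc (D ℕ.+ D)) L (normSq s)) (sum-replicate-zero n)
      (ΔConst-∑ (suc (D ℕ.+ D)) L _ (λ _ → + 0) square)
    where
    square : ∀ i → Deg≤ (D ℕ.+ D) L (λ j → s i j * s i j)
    square i = subst₂ (λ D′ c → ΔConst D′ L (λ j → s i j * s i j) c) (ℕ.+-suc D D)
                 (ℤ.*-zeroʳ (+ pascal D (suc D) * Δ^ D (s i) 0))
                 (ΔConst-* L D (suc D) (s i) (s i) (Deg≤⇒ΔConst-Δ^ D L (s i) D≤L (q i)) (q i))

  i*i≡+∣i∣*∣i∣ : ∀ i → i * i ≡ + (∣ i ∣ ℕ.* ∣ i ∣)
  i*i≡+∣i∣*∣i∣ (+ n)    = sym (ℤ.pos-* n n)
  i*i≡+∣i∣*∣i∣ -[1+ n ] = refl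

  +r+∑≡0 : ∀ {n} r (f : Fin n → ℕ) → + r + sum (λ i → + f i) ≡ + 0 → r ≡ 0 × (∀ i → f i ≡ 0)
  +r+∑≡0 {zero}  r f eq = ℤ.+-injective (trans (sym (ℤ.+-identityʳ (+ r))) eq) , λ ()
  +r+∑≡0 {suc n} r f eq with +r+∑≡0 (r ℕ.+ f zero) (λ i → f (suc i)) eq′
    where
    eq′ : + (r ℕ.+ f zero) + sum (λ i → + f (suc i)) ≡ + 0
    eq′ = trans (cong (_+ sum (λ i → + f (suc i))) (ℤ.pos-+ r (f zero)))
                (trans (ℤ.+-assoc (+ r) (+ f zero) (sum (λ i → + f (suc i)))) eq)
  ... | r+f₀≡0 , fₛ≡0 = ℕ.m+n≡0⇒m≡0 r r+f₀≡0 , λ where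
    zero    → ℕ.m+n≡0⇒n≡0 r r+f₀≡0
    (suc i) → fₛ≡0 i

  -- The leading coefficient of ‖s‖² in degree 2e is a positive multiple of ∑ cᵢ², which is nonzero.
  normSq-nonconstant : ∀ {n} D L (s : Fin n → Seq) → D ℕ.+ D ≤ L → (∀ i → Deg≤ D L (s i)) →
                       Nonconstant L s → ¬ ConstantOn L (normSq s)
  normSq-nonconstant {n} D L s 2D≤L q nonconst const
    with exact-degree D L s (ℕ.≤-trans (ℕ.m≤m+n D D) 2D≤L) q nonconst
  ... | suc e , _ , e≤D , c , qc , i , ci≢0 = ℕ.<⇒≢ 0<fᵢ (sym (proj₂ (+r+∑≡0 0 f ∑f≡0) i))
    where
    w = pascal (suc e) (suc e)
    f : Fin n → ℕ
    f i = w ℕ.* (∣ c i ∣ ℕ.* ∣ c i ∣)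
    term : ∀ i → + w * c i * c i ≡ + f i
    term i = trans (ℤ.*-assoc (+ w) (c i) (c i))
               (trans (cong (+ w *_) (i*i≡+∣i∣*∣i∣ (c i))) (sym (ℤ.pos-* w _)))
    leading : ΔConst (suc e ℕ.+ suc e) L (normSq s) (sum (λ i → + f i))
    leading = subst (ΔConst (suc e ℕ.+ suc e) L (normSq s)) (sum-cong-≗ term)
                (ΔConst-∑ (suc e ℕ.+ suc e) L _ _
                  (λ i → ΔConst-* L (suc e) (suc e) (s i) (s i) (qc i) (qc i)))
    ∑f≡0 : + 0 + sum (λ i → + f i) ≡ + 0
    ∑f≡0 = trans (ℤ.+-identityˡ _)
             (ΔConst-unique _ L (normSq s) (ℕ.≤-trans (ℕ.+-mono-≤ e≤D e≤D) 2D≤L)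
               leading (constant⇒Deg≤ (e ℕ.+ suc e) L (normSq s) const))
    1≤∣ci∣ : 1 ≤ ∣ c i ∣
    1≤∣ci∣ = ℕ.n≢0⇒n>0 (λ ∣ci∣≡0 → ci≢0 (ℤ.∣i∣≡0⇒i≡0 ∣ci∣≡0))
    0<fᵢ : 0 < f i
    0<fᵢ = ℕ.*-mono-≤ (pascal-pos (suc e) (suc e)) (ℕ.*-mono-≤ 1≤∣ci∣ 1≤∣ci∣)

  ap-Deg≤1 : ∀ L x y → Deg≤ 1 L (λ j → x + + j * y)
  ap-Deg≤1 zero          x y = tt
  ap-Deg≤1 (suc zero)    x y = tt
  ap-Deg≤1 (suc (suc L)) x y j _ =
    trans (cong₂ (λ a b → (x + a * y - (x + b * y)) - (x + b * y - (x + + j * y)))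
                 (ℤ.pos-+ 2 j) (ℤ.pos-+ 1 j))
          (Δ²-linear x y (+ j))
    where
    Δ²-linear : ∀ x y j → x + (+ 2 + j) * y - (x + (+ 1 + j) * y) - (x + (+ 1 + j) * y - (x + j * y)) ≡ + 0
    Δ²-linear = solve-∀

module Digits where
  open import Data.Integer using (ℤ; +_; _+_; _-_; -_; _*_; ∣_∣)
  open import Data.Vec using (Vec; []; _∷_; lookup)
  import Data.Integer.Properties as ℤ
  open import Data.Integer.Tactic.RingSolver using (solve-∀)
  import Data.Nat.Tactic.RingSolver as ℕ-Solver
  open FiniteDifferences

  fromDigits : ℕ → ∀ {n} → (Fin n → ℤ) → ℤ
  fromDigits B {zero}  w = + 0
  fromDigits B {suc n} w = w zero + + B * fromDigits B (λ i → w (suc i))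

  fromDigits-cong : ∀ B {n} (v w : Fin n → ℤ) → (∀ i → v i ≡ w i) → fromDigits B v ≡ fromDigits B w
  fromDigits-cong B {zero}  v w v≡w = refl
  fromDigits-cong B {suc n} v w v≡w =
    cong₂ (λ x y → x + + B * y) (v≡w zero) (fromDigits-cong B _ _ (λ i → v≡w (suc i)))

  fromDigits-- : ∀ B {n} (v w : Fin n → ℤ) →
                 fromDigits B (λ i → v i - w i) ≡ fromDigits B v - fromDigits B w
  fromDigits-- B {zero}  v w = refl
  fromDigits-- B {suc n} v w =
    trans (cong (λ x → v zero - w zero + + B * x) (fromDigits-- B (λ i → v (suc i)) (λ i → w (suc i))))
          (horner-- (v zero) (w zero) (+ B) _ _)
    where
    horner-- : ∀ a b β x y → a - b + β * (x - y) ≡ (a + β * x) - (b + β * y)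
    horner-- = solve-∀

  digit+B*r≡0 : ∀ B a r → ∣ a ∣ < B → a + + B * r ≡ + 0 → a ≡ + 0 × r ≡ + 0
  digit+B*r≡0 B a r ∣a∣<B eq = a≡0 , r≡0
    where
    a≡-Br : a ≡ - (+ B * r)
    a≡-Br = trans (add-sub a (+ B * r)) (trans (cong (_- + B * r) eq) (ℤ.+-identityˡ _))
      where
      add-sub : ∀ a x → a ≡ a + x - x
      add-sub = solve-∀
    ∣a∣≡B∣r∣ : ∣ a ∣ ≡ B ℕ.* ∣ r ∣
    ∣a∣≡B∣r∣ = trans (cong ∣_∣ a≡-Br) (trans (ℤ.∣-i∣≡∣i∣ (+ B * r)) (ℤ.abs-* (+ B) r))
    r≡0 : r ≡ + 0
    r≡0 = ℤ.∣i∣≡0⇒i≡0 (ℕ.n<1⇒n≡0 (ℕ.*-cancelˡ-< B _ _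
            (subst₂ _<_ ∣a∣≡B∣r∣ (sym (ℕ.*-identityʳ B)) ∣a∣<B)))
    a≡0 : a ≡ + 0
    a≡0 = trans a≡-Br (trans (cong (λ x → - (+ B * x)) r≡0) (cong -_ (ℤ.*-zeroʳ (+ B))))

  fromDigits≡0 : ∀ B {n} (w : Fin n → ℤ) → (∀ i → ∣ w i ∣ < B) → fromDigits B w ≡ + 0 →
                 ∀ i → w i ≡ + 0
  fromDigits≡0 B {suc n} w small eq zero    = proj₁ (digit+B*r≡0 B (w zero) _ (small zero) eq)
  fromDigits≡0 B {suc n} w small eq (suc i) =
    fromDigits≡0 B (λ i → w (suc i)) (λ i → small (suc i))
      (proj₂ (digit+B*r≡0 B (w zero) _ (small zero) eq)) i

  Δ-fromDigits : ∀ B {n} L t c (u : Fin n → Seq) →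
                 (∀ j → j ≤ suc L → t j ≡ c + fromDigits B (λ i → u i j)) →
                 ∀ j → j ≤ L → Δ t j ≡ fromDigits B (λ i → Δ (u i) j)
  Δ-fromDigits B L t c u rep j j≤L =
    trans (cong₂ _-_ (rep (suc j) (s≤s j≤L)) (rep j (ℕ.m≤n⇒m≤1+n j≤L)))
          (trans (cancel-offset c _ _) (sym (fromDigits-- B (λ i → u i (suc j)) (λ i → u i j))))
    where
    cancel-offset : ∀ c x y → c + x - (c + y) ≡ x - y
    cancel-offset = solve-∀

  Δ-digit-bound : ∀ {n} L (u : Fin n → Seq) b → (∀ j → j ≤ suc L → ∀ i → ∣ u i j ∣ ≤ b) →
                  ∀ j → j ≤ L → ∀ i → ∣ Δ (u i) j ∣ ≤ b ℕ.+ b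
  Δ-digit-bound L u b small j j≤L i =
    ℕ.≤-trans (ℤ.∣i-j∣≤∣i∣+∣j∣ (u i (suc j)) (u i j))
      (ℕ.+-mono-≤ (small (suc j) (s≤s j≤L) i) (small j (ℕ.m≤n⇒m≤1+n j≤L) i))

  -- The digits of Δᴰ t are at most 2ᴰ b in absolute value, so when 2ᴰ b < B no carries occur
  -- and Δᴰ t = 0 forces every Δᴰ uᵢ = 0.
  digits-ΔConst0 : ∀ B {n} D L t (u : Fin n → Seq) b → 2 ^ D ℕ.* b < B →
                   (∀ j → j ≤ L → t j ≡ fromDigits B (λ i → u i j)) →
                   (∀ j → j ≤ L → ∀ i → ∣ u i j ∣ ≤ b) →
                   ΔConst D L t (+ 0) → ∀ i → ΔConst D L (u i) (+ 0)
  digits-ΔConst0 B zero L t u b b<B rep small q i j j≤L =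
    fromDigits≡0 B (λ i → u i j) (λ i → ℕ.≤-<-trans (small j j≤L i) (subst (_< B) (ℕ.+-identityʳ b) b<B))
      (trans (sym (rep j j≤L)) (q j j≤L)) i
  digits-ΔConst0 B (suc D) zero    t u b _ rep small q i = tt
  digits-ΔConst0 B (suc D) (suc L) t u b 2ᴰ⁺¹b<B rep small q =
    digits-ΔConst0 B D L (Δ t) (λ i → Δ (u i)) (b ℕ.+ b) (subst (_< B) (double (2 ^ D) b) 2ᴰ⁺¹b<B)
      (Δ-fromDigits B L t (+ 0) u (λ j j≤ → trans (rep j j≤) (sym (ℤ.+-identityˡ _))))
      (Δ-digit-bound L u b small) q
    where
    double : ∀ x b → 2 ℕ.* x ℕ.* b ≡ x ℕ.* (b ℕ.+ b)
    double = ℕ-Solver.solve-∀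

  digits-Deg≤ : ∀ B {n} E L t c (u : Fin n → Seq) b → 2 ^ E ℕ.* (b ℕ.+ b) < B →
                (∀ j → j ≤ L → t j ≡ c + fromDigits B (λ i → u i j)) →
                (∀ j → j ≤ L → ∀ i → ∣ u i j ∣ ≤ b) →
                Deg≤ E L t → ∀ i → Deg≤ E L (u i)
  digits-Deg≤ B E zero    t c u b _     rep small q i = tt
  digits-Deg≤ B E (suc L) t c u b bound rep small q =
    digits-ΔConst0 B E L (Δ t) (λ i → Δ (u i)) (b ℕ.+ b) bound
      (Δ-fromDigits B L t c u rep) (Δ-digit-bound L u b small) q

  fromDigitsℕ : ℕ → ∀ {n} → Vec ℕ n → ℕ
  fromDigitsℕ B []      = 0
  fromDigitsℕ B (x ∷ v) = x ℕ.+ B ℕ.* fromDigitsℕ B v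

  ‖_‖² : ∀ {n} → Vec ℕ n → ℕ
  ‖ []    ‖² = 0
  ‖ x ∷ v ‖² = x ℕ.* x ℕ.+ ‖ v ‖²

  toℤ-fromDigitsℕ : ∀ B {n} (v : Vec ℕ n) → + fromDigitsℕ B v ≡ fromDigits B (λ i → + lookup v i)
  toℤ-fromDigitsℕ B []      = refl
  toℤ-fromDigitsℕ B (x ∷ v) =
    trans (ℤ.pos-+ x _) (cong (λ z → + x + z) (trans (ℤ.pos-* B _) (cong (+ B *_) (toℤ-fromDigitsℕ B v))))

  toℤ-‖‖² : ∀ {n} (v : Vec ℕ n) → + ‖ v ‖² ≡ normSq (λ i _ → + lookup v i) 0
  toℤ-‖‖² []      = refl
  toℤ-‖‖² (x ∷ v) = trans (ℤ.pos-+ (x ℕ.* x) _) (cong₂ _+_ (ℤ.pos-* x x) (toℤ-‖‖² v))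

  shift-offset : ∀ a b R v → a ℕ.+ b ≡ R ℕ.+ v → + a ≡ (+ R - + b) + + v
  shift-offset a b R v eq =
    trans (add-sub (+ a) (+ b))
      (trans (cong (_- + b) (trans (sym (ℤ.pos-+ a b)) (trans (cong +_ eq) (ℤ.pos-+ R v))))
        (sub-comm (+ R) (+ v) (+ b)))
    where
    add-sub : ∀ a b → a ≡ a + b - b
    add-sub = solve-∀
    sub-comm : ∀ r v b → r + v - b ≡ r - b + v
    sub-comm = solve-∀

open FiniteDifferences
open Digits

open import Data.Nat using (ℕ; suc; _+_; _*_; _^_; _≤_; _<_; _∸_; _/_; _%_; _≤?_; ⌊_/2⌋)
import Data.Nat.DivMod as DM
open import Data.Nat.Logarithm using (⌊log₂_⌋; ⌊log₂⌋-mono-≤; ⌊log₂⌊n/2⌋⌋≡⌊log₂n⌋∸1; ⌊log₂[2^n]⌋≡n)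
open import Data.Nat.Induction using (<-rec)
open import Data.Integer as ℤ using (ℤ; +_)
import Data.Integer.Properties as ℤ
open import Data.Integer.Tactic.RingSolver using (solve-∀)
open import Data.Fin.Subset using (Subset; ∣_∣; _∈_; ⋃; ⁅_⁆)
open import Data.Fin.Subset.Properties
  using (x∈⁅x⁆; x∈⁅y⁆⇒x≡y; x∈p∪q⁻; p⊆p∪q; q⊆p∪q; p⊂q⇒∣p∣<∣q∣; ∉⊥)
open import Data.Vec using (Vec; []; _∷_; lookup; replicate)
import Data.Vec.Properties as Vec
open import Data.Vec.Relation.Unary.All using ([]; _∷_) renaming (All to AllV)
import Data.Vec.Relation.Unary.All as AllV
import Data.Vec.Relation.Unary.All.Properties as AllV
open import Data.List as List using (List; []; _∷_; length; map; filter; upTo; cartesianProduct; [_])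
import Data.List.Properties as List
open import Data.List.Relation.Unary.All as All using (All; []; _∷_)
import Data.List.Relation.Unary.All.Properties as All
open import Data.List.Relation.Unary.Any using (here; there)
open import Data.List.Relation.Unary.Unique.Propositional using (Unique; []; _∷_)
import Data.List.Relation.Unary.Unique.Propositional.Properties as Unique
open import Data.List.Membership.Propositional using () renaming (_∈_ to _∈ₗ_)
open import Data.List.Membership.Propositional.Properties
  using (∈-map⁻; ∈-filter⁻; ∈-cartesianProduct⁻; ∈-upTo⁻)
open import Data.List.Relation.Binary.Sublist.Propositional.Properties
  using (filter⁺; filter-⊆; length-mono-≤)

-- Iterated spheres contain no long progressions

bounded-choice : ∀ {A : Set} {P : ℕ → A → Set} L → A → (∀ j → j ≤ L → Σ A (P j)) →
                 Σ (ℕ → A) λ f → ∀ j → j ≤ L → P j (f j)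
bounded-choice {A} {P} L default h = (λ j → pick j (j ≤? L)) , λ j j≤L → pick-spec j (j ≤? L) j≤L
  where
  pick : ∀ j → Dec (j ≤ L) → A
  pick j (yes j≤L) = proj₁ (h j j≤L)
  pick j (no  _)   = default
  pick-spec : ∀ j (j≤?L : Dec (j ≤ L)) → j ≤ L → P j (pick j j≤?L)
  pick-spec j (yes j≤L) _   = proj₂ (h j j≤L)
  pick-spec j (no  j≰L) j≤L = ⊥-elim (j≰L j≤L)

-- At a level, the next digit vector lies in [0, bound)ⁿ and is read in the given base;
-- loss bounds the factor lost when the radius of this level is chosen by pigeonhole.
record Level : Set where
  constructor level
  field
    bound base loss : ℕ

-- OnSpheres lv (R ∷ Rs) r v: the integer ‖v‖² − (R − Bⁿ) has base-B digits w ∈ [0, d)ⁿ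
-- (written without subtraction), and w lies on the spheres of the remaining levels;
-- after the last level ‖w‖² = r.  Radius lists shorter than lv are junk.
OnSpheres : ∀ {n} → List Level → List ℕ → ℕ → Vec ℕ n → Set
OnSpheres             []                   Rs       r v = ‖ v ‖² ≡ r
OnSpheres             (level d B T ∷ lv)   []       r v = ⊥
OnSpheres {n} (level d B T ∷ lv) (R ∷ Rs) r v =
  Σ (Vec ℕ n) λ w → AllV (_< d) w × ‖ v ‖² + B ^ n ≡ R + fromDigitsℕ B w × OnSpheres lv Rs r w

-- Along a curve of degree ≤ D the squared norm has degree ≤ 2D, so its digits do too,
-- as long as no carries occur.
Admissible : List Level → ℕ → ℕ → Set
Admissible []                 D L = D + D ≤ L
Admissible (level d B T ∷ lv) D L = D + D ≤ L × 2 ^ (D + D) * (d + d) < B × Admissible lv (D + D) L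

components : ∀ {n} → (ℕ → Vec ℕ n) → Fin n → Seq
components s i j = + lookup (s j) i

digits-bounded : ∀ {n} d (w : Vec ℕ n) → AllV (_< d) w → ∀ i → ℤ.∣ + lookup w i ∣ ≤ d
digits-bounded d w w<d i = ℕ.<⇒≤ (AllV.lookup⁺ w<d i)

no-nonconstant-curve : ∀ {n} lv Rs r D L (s : ℕ → Vec ℕ n) → Admissible lv D L →
                       (∀ i → Deg≤ D L (components s i)) →
                       (∀ j → j ≤ L → OnSpheres lv Rs r (s j)) →
                       ¬ Nonconstant L (components s)
no-nonconstant-curve [] Rs r D L s 2D≤L deg on nonconst =
  normSq-nonconstant D L (components s) 2D≤L deg nonconst λ j j≤L →
    trans (sym (toℤ-‖‖² (s j))) (trans (cong +_ (trans (on j j≤L) (sym (on 0 z≤n)))) (toℤ-‖‖² (s 0)))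
no-nonconstant-curve (level d B T ∷ lv) []       r D L s adm deg on _ = on 0 z≤n
no-nonconstant-curve {n} (level d B T ∷ lv) (R ∷ Rs) r D L s (2D≤L , noCarry , adm) deg on nonconst =
  no-nonconstant-curve lv Rs r (D + D) L w adm deg-w (λ j j≤L → proj₂ (proj₂ (w-spec j j≤L))) nonconst-w
  where
  w = proj₁ (bounded-choice L (replicate n 0) on)
  w-spec = proj₂ (bounded-choice L (replicate n 0) on)
  t : Seq
  t = normSq (components s)
  c : ℤ
  c = + R ℤ.- + (B ^ n)
  rep : ∀ j → j ≤ L → t j ≡ c ℤ.+ fromDigits B (λ i → components w i j)
  rep j j≤L = trans (sym (toℤ-‖‖² (s j)))
                (trans (shift-offset _ _ R _ (proj₁ (proj₂ (w-spec j j≤L))))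
                  (cong (λ z → c ℤ.+ z) (toℤ-fromDigitsℕ B (w j))))
  D≤L : D ≤ L
  D≤L = ℕ.≤-trans (ℕ.m≤m+n D D) 2D≤L
  deg-w : ∀ i → Deg≤ (D + D) L (components w i)
  deg-w = digits-Deg≤ B (D + D) L t c (components w) d noCarry rep
            (λ j j≤L → digits-bounded d (w j) (proj₁ (w-spec j j≤L)))
            (normSq-Deg≤ D L (components s) D≤L deg)
  nonconst-w : Nonconstant L (components w)
  nonconst-w const = normSq-nonconstant D L (components s) 2D≤L deg nonconst λ j j≤L →
    trans (rep j j≤L)
      (trans (cong (λ z → c ℤ.+ z) (fromDigits-cong B _ _ (λ i → const i j j≤L))) (sym (rep 0 z≤n)))

Encoded : ∀ {N} n → ℕ → ℕ → List Level → List ℕ → ℕ → Fin N → Set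
Encoded n d B lv Rs r i = Σ (Vec ℕ n) λ v → AllV (_< d) v × toℕ i ≡ fromDigitsℕ B v × OnSpheres lv Rs r v

apFree : ∀ {N} n d B lv Rs r L (A : Subset N) → (∀ i → i ∈ A → Encoded n d B lv Rs r i) →
         Admissible lv 1 L → 1 ≤ L → 2 * (d + d) < B → APFree (suc L) A
apFree n d B lv Rs r L A encoded adm 1≤L noCarry (x , y , y≢0 , ap) =
  no-nonconstant-curve lv Rs r 1 L s adm deg-s (λ j j≤L → proj₂ (proj₂ (s-spec j j≤L))) nonconst
  where
  t : Seq
  t j = x ℤ.+ + j ℤ.* y
  Point : ℕ → Vec ℕ n → Set
  Point j v = AllV (_< d) v × t j ≡ + 1 ℤ.+ fromDigits B (λ k → + lookup v k) × OnSpheres lv Rs r v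
  point : ∀ j → j ≤ L → Σ (Vec ℕ n) (Point j)
  point j j≤L with ap j (s≤s j≤L)
  ... | i , 1+i≡tj , i∈A with encoded i i∈A
  ...   | v , v<d , i≡v , on =
    v , v<d ,
    trans (sym 1+i≡tj)
      (trans (ℤ.pos-+ 1 (toℕ i)) (cong (λ z → + 1 ℤ.+ z) (trans (cong +_ i≡v) (toℤ-fromDigitsℕ B v)))) ,
    on
  s = proj₁ (bounded-choice L (replicate n 0) point)
  s-spec = proj₂ (bounded-choice L (replicate n 0) point)
  rep : ∀ j → j ≤ L → t j ≡ + 1 ℤ.+ fromDigits B (λ i → components s i j)
  rep j j≤L = proj₁ (proj₂ (s-spec j j≤L))
  deg-s : ∀ i → Deg≤ 1 L (components s i)
  deg-s = digits-Deg≤ B 1 L t (+ 1) (components s) d noCarry rep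
            (λ j j≤L → digits-bounded d (s j) (proj₁ (s-spec j j≤L))) (ap-Deg≤1 L x y)
  nonconst : Nonconstant L (components s)
  nonconst const = y≢0 (trans (y≡t₁-t₀ x y) (ℤ.i≡j⇒i-j≡0 t₁≡t₀))
    where
    t₁≡t₀ : t 1 ≡ t 0
    t₁≡t₀ = trans (rep 1 1≤L) (trans (cong (λ z → + 1 ℤ.+ z) (fromDigits-cong B _ _ (λ i → const i 1 1≤L)))
              (sym (rep 0 z≤n)))
    y≡t₁-t₀ : ∀ x y → y ≡ (x ℤ.+ + 1 ℤ.* y) ℤ.- (x ℤ.+ + 0 ℤ.* y)
    y≡t₁-t₀ = solve-∀

-- Iterated spheres are dense

box : ∀ n → ℕ → List (Vec ℕ n)
box zero    d = [ [] ]
box (suc n) d = map (uncurry _∷_) (cartesianProduct (upTo d) (box n d))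

length-cartesianProduct : ∀ {A B : Set} (xs : List A) (ys : List B) →
                          length (cartesianProduct xs ys) ≡ length xs * length ys
length-cartesianProduct []       ys = refl
length-cartesianProduct (x ∷ xs) ys =
  trans (List.length-++ (map (x ,_) ys))
        (cong₂ _+_ (List.length-map (x ,_) ys) (length-cartesianProduct xs ys))

length-box : ∀ n d → length (box n d) ≡ d ^ n
length-box zero    d = refl
length-box (suc n) d = begin
  length (box (suc n) d)                       ≡⟨ List.length-map _ (cartesianProduct (upTo d) (box n d)) ⟩
  length (cartesianProduct (upTo d) (box n d)) ≡⟨ length-cartesianProduct (upTo d) (box n d) ⟩
  length (upTo d) * length (box n d)           ≡⟨ cong₂ _*_ (List.length-upTo d) (length-box n d) ⟩
  d * d ^ n                                    ∎
  where open ≡-Reasoning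

box-unique : ∀ n d → Unique (box n d)
box-unique zero    d = [] ∷ []
box-unique (suc n) d =
  Unique.map⁺ ∷-injective (Unique.cartesianProduct⁺ (Unique.upTo⁺ d) (box-unique n d))
  where
  ∷-injective : ∀ {p q : ℕ × Vec ℕ n} → uncurry _∷_ p ≡ uncurry _∷_ q → p ≡ q
  ∷-injective {x , v} {y , w} eq = cong₂ _,_ (Vec.∷-injectiveˡ eq) (Vec.∷-injectiveʳ eq)

box-bounded : ∀ n d {v} → v ∈ₗ box n d → AllV (_< d) v
box-bounded zero    d (here refl) = []
box-bounded (suc n) d v∈box with (x , w) , xw∈ , refl ← ∈-map⁻ (uncurry _∷_) v∈box =
  let x∈ , w∈ = ∈-cartesianProduct⁻ (upTo d) (box n d) xw∈ in ∈-upTo⁻ x∈ ∷ box-bounded n d w∈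

length-filter-split : ∀ {A : Set} {P : A → Set} (P? : ∀ x → Dec (P x)) xs →
                      length xs ≡ length (filter P? xs) + length (filter (λ x → ¬? (P? x)) xs)
length-filter-split P? []       = refl
length-filter-split P? (x ∷ xs) with does (P? x)
... | true  = cong suc (length-filter-split P? xs)
... | false = trans (cong suc (length-filter-split P? xs)) (sym (ℕ.+-suc _ _))

module _ {A : Set} (f : A → ℕ) where

  fibre : ℕ → List A → List A
  fibre R = filter (λ x → f x ℕ.≟ R)

  ∈-fibre⁻ : ∀ {R x} xs → x ∈ₗ fibre R xs → x ∈ₗ xs × f x ≡ R
  ∈-fibre⁻ {R} xs = ∈-filter⁻ (λ x → f x ℕ.≟ R) {xs = xs}

  pigeonhole : ∀ M xs → All (λ x → f x < M) xs → ∃ λ R → length xs ≤ M * length (fibre R xs)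
  pigeonhole zero    []       []      = 0 , z≤n
  pigeonhole (suc M) xs       f<1+M = larger-fibre (pigeonhole M ys ys-bounded)
    where
    ys = filter (λ x → ¬? (f x ℕ.≟ M)) xs
    ys-bounded : All (λ x → f x < M) ys
    ys-bounded = All.zipWith (λ (f<1+M , f≢M) → ℕ.≤∧≢⇒< (ℕ.≤-pred f<1+M) f≢M)
                   (All.filter⁺ _ f<1+M , All.all-filter _ xs)
    c₀ = length (fibre M xs)
    |xs|≡c₀+|ys| : length xs ≡ c₀ + length ys
    |xs|≡c₀+|ys| = length-filter-split (λ x → f x ℕ.≟ M) xs
    larger-fibre : (∃ λ R → length ys ≤ M * length (fibre R ys)) →
                   ∃ λ R → length xs ≤ suc M * length (fibre R xs)
    larger-fibre (R , |ys|≤M*|fibreR|) = with-larger (ℕ.≤-total c₀ cᵣ)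
      where
      cᵣ = length (fibre R xs)
      |ys|≤M*cᵣ : length ys ≤ M * cᵣ
      |ys|≤M*cᵣ = ℕ.≤-trans |ys|≤M*|fibreR|
                    (ℕ.*-monoʳ-≤ M (length-mono-≤ (filter⁺ _ _ (λ { refl p → p }) (filter-⊆ _ xs))))
      with-larger : c₀ ≤ cᵣ ⊎ cᵣ ≤ c₀ → ∃ λ R → length xs ≤ suc M * length (fibre R xs)
      with-larger (inj₁ c₀≤cᵣ) =
        R , ℕ.≤-trans (ℕ.≤-reflexive |xs|≡c₀+|ys|) (ℕ.+-mono-≤ c₀≤cᵣ |ys|≤M*cᵣ)
      with-larger (inj₂ cᵣ≤c₀) =
        M , ℕ.≤-trans (ℕ.≤-reflexive |xs|≡c₀+|ys|)
              (ℕ.+-monoʳ-≤ c₀ (ℕ.≤-trans |ys|≤M*cᵣ (ℕ.*-monoʳ-≤ M cᵣ≤c₀)))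

fromDigitsℕ<B^n : ∀ B {n} (v : Vec ℕ n) → AllV (_< B) v → fromDigitsℕ B v < B ^ n
fromDigitsℕ<B^n B []      []           = s≤s z≤n
fromDigitsℕ<B^n B {suc n} (x ∷ v) (x<B ∷ v<B) = begin-strict
  x + B * fromDigitsℕ B v      <⟨ ℕ.+-monoˡ-< _ x<B ⟩
  B + B * fromDigitsℕ B v      ≡⟨ ℕ.*-suc B _ ⟨
  B * suc (fromDigitsℕ B v)    ≤⟨ ℕ.*-monoʳ-≤ B (fromDigitsℕ<B^n B v v<B) ⟩
  B ^ suc n                    ∎
  where open ℕ.≤-Reasoning

digit-unique : ∀ B x y r r′ → x < B → y < B → x + B * r ≡ y + B * r′ → x ≡ y × r ≡ r′
digit-unique B x y r r′ x<B y<B eq = x≡y , r≡r′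
  where
  instance
    B≢0 : ℕ.NonZero B
    B≢0 = ℕ.>-nonZero (ℕ.≤-<-trans z≤n x<B)
  x≡y : x ≡ y
  x≡y = begin
    x                ≡⟨ DM.m<n⇒m%n≡m x<B ⟨
    x % B            ≡⟨ DM.[m+kn]%n≡m%n x r B ⟨
    (x + r * B) % B  ≡⟨ cong (λ z → (x + z) % B) (ℕ.*-comm r B) ⟩
    (x + B * r) % B  ≡⟨ cong (_% B) eq ⟩
    (y + B * r′) % B ≡⟨ cong (λ z → (y + z) % B) (ℕ.*-comm B r′) ⟩
    (y + r′ * B) % B ≡⟨ DM.[m+kn]%n≡m%n y r′ B ⟩
    y % B            ≡⟨ DM.m<n⇒m%n≡m y<B ⟩
    y                ∎
    where open ≡-Reasoning
  r≡r′ : r ≡ r′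
  r≡r′ = ℕ.*-cancelˡ-≡ r r′ B (ℕ.+-cancelˡ-≡ x _ _ (trans eq (cong (_+ B * r′) (sym x≡y))))

fromDigitsℕ-injective : ∀ B {n} (v w : Vec ℕ n) → AllV (_< B) v → AllV (_< B) w →
                        fromDigitsℕ B v ≡ fromDigitsℕ B w → v ≡ w
fromDigitsℕ-injective B []      []      _           _           _  = refl
fromDigitsℕ-injective B (x ∷ v) (y ∷ w) (x<B ∷ v<B) (y<B ∷ w<B) eq =
  let x≡y , rest≡ = digit-unique B x y _ _ x<B y<B eq
  in cong₂ _∷_ x≡y (fromDigitsℕ-injective B v w v<B w<B rest≡)

‖‖²≤ : ∀ d {n} (v : Vec ℕ n) → AllV (_< d) v → ‖ v ‖² ≤ n * (d * d)
‖‖²≤ d []      []           = z≤n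
‖‖²≤ d (x ∷ v) (x<d ∷ v<d) = ℕ.+-mono-≤ (ℕ.*-mono-≤ (ℕ.<⇒≤ x<d) (ℕ.<⇒≤ x<d)) (‖‖²≤ d v v<d)

Unique-map⁺ : ∀ {A B : Set} (f : A → B) {xs} → (∀ {x y} → x ∈ₗ xs → y ∈ₗ xs → f x ≡ f y → x ≡ y) →
              Unique xs → Unique (map f xs)
Unique-map⁺ f {[]}     inj []         = []
Unique-map⁺ f {x ∷ xs} inj (x∉ ∷ uxs) =
  All.map⁺ (All.tabulate (λ y∈ fx≡fy → All.lookup x∉ y∈ (inj (here refl) (there y∈) fx≡fy)))
  ∷ Unique-map⁺ f (λ x∈ y∈ → inj (there x∈) (there y∈)) uxs

record Shell (n d B : ℕ) (G′ : List (Vec ℕ n)) : Set where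
  field
    radius  : ℕ
    points  : List (Vec ℕ n)
    unique  : Unique points
    bounded : All (AllV (_< d)) points
    digits  : All (λ v → ∃ λ w → w ∈ₗ G′ × ‖ v ‖² + B ^ n ≡ radius + fromDigitsℕ B w) points
    dense   : d ^ n * length G′ ≤ suc (n * (d * d) + B ^ n) * length points

-- Pigeonhole over pairs (v, w) ∈ [0, d)ⁿ × G′ by the value of ‖v‖² − ∑ wₖ Bᵏ, which takes
-- fewer than n d² + Bⁿ + 1 values (shifted by Bⁿ to stay in ℕ); w is determined by v and R.
shell : ∀ n d B (G′ : List (Vec ℕ n)) → Unique G′ → All (AllV (_< B)) G′ → Shell n d B G′
shell n d B G′ unique-G′ G′<B = record
  { radius  = R
  ; points  = map proj₁ F
  ; unique  = Unique-map⁺ proj₁ same-v⇒same-w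
                (Unique.filter⁺ _ (Unique.cartesianProduct⁺ (box-unique n d) unique-G′))
  ; bounded = All.map⁺ (All.tabulate λ p∈F → box-bounded n d (proj₁ (∈P⁻ (∈F⇒∈P p∈F))))
  ; digits  = All.map⁺ (All.tabulate λ {p} p∈F → proj₂ p , proj₂ (∈P⁻ (∈F⇒∈P p∈F)) , on-shell p∈F)
  ; dense   = count
  }
  where
  P = cartesianProduct (box n d) G′
  f : Vec ℕ n × Vec ℕ n → ℕ
  f (v , w) = ‖ v ‖² + B ^ n ∸ fromDigitsℕ B w
  ∈P⁻ : ∀ {p} → p ∈ₗ P → proj₁ p ∈ₗ box n d × proj₂ p ∈ₗ G′
  ∈P⁻ = ∈-cartesianProduct⁻ (box n d) G′
  w<B : ∀ {p} → p ∈ₗ P → AllV (_< B) (proj₂ p)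
  w<B p∈P = All.lookup G′<B (proj₂ (∈P⁻ p∈P))
  value≤ : ∀ {p} → p ∈ₗ P → fromDigitsℕ B (proj₂ p) ≤ ‖ proj₁ p ‖² + B ^ n
  value≤ p∈P = ℕ.≤-trans (ℕ.<⇒≤ (fromDigitsℕ<B^n B _ (w<B p∈P))) (ℕ.m≤n+m _ _)
  f-bounded : All (λ p → f p < suc (n * (d * d) + B ^ n)) P
  f-bounded = All.tabulate λ {p} p∈P →
    s≤s (ℕ.≤-trans (ℕ.m∸n≤m _ (fromDigitsℕ B (proj₂ p)))
          (ℕ.+-monoˡ-≤ (B ^ n) (‖‖²≤ d _ (box-bounded n d (proj₁ (∈P⁻ p∈P))))))
  R = proj₁ (pigeonhole f _ P f-bounded)
  F = fibre f R P
  ∈F⇒∈P : ∀ {p} → p ∈ₗ F → p ∈ₗ P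
  ∈F⇒∈P p∈F = proj₁ (∈-fibre⁻ f P p∈F)
  on-shell : ∀ {p} → p ∈ₗ F → ‖ proj₁ p ‖² + B ^ n ≡ R + fromDigitsℕ B (proj₂ p)
  on-shell p∈F = trans (sym (ℕ.m∸n+n≡m (value≤ (∈F⇒∈P p∈F)))) (cong (_+ _) (proj₂ (∈-fibre⁻ f P p∈F)))
  same-v⇒same-w : ∀ {p q} → p ∈ₗ F → q ∈ₗ F → proj₁ p ≡ proj₁ q → p ≡ q
  same-v⇒same-w {v , w} {.v , w′} p∈F q∈F refl =
    cong (v ,_) (fromDigitsℕ-injective B w w′ (w<B (∈F⇒∈P p∈F)) (w<B (∈F⇒∈P q∈F))
      (ℕ.+-cancelˡ-≡ R _ _ (trans (sym (on-shell p∈F)) (on-shell q∈F))))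
  M = suc (n * (d * d) + B ^ n)
  count : d ^ n * length G′ ≤ M * length (map proj₁ F)
  count = begin
    d ^ n * length G′             ≡⟨ cong (_* length G′) (length-box n d) ⟨
    length (box n d) * length G′  ≡⟨ length-cartesianProduct (box n d) G′ ⟨
    length P                      ≤⟨ proj₂ (pigeonhole f M P f-bounded) ⟩
    M * length F                  ≡⟨ cong (M *_) (List.length-map proj₁ F) ⟨
    M * length (map proj₁ F)      ∎
    where open ℕ.≤-Reasoning

-- The pigeonhole step at a level with digit bound d′ and base B′, applied to points of [0, d)ⁿ,
-- loses a factor n d² + B′ⁿ + 1 ≤ T d′ⁿ, of which d′ⁿ is regained by the size of the next level.
LossBounded : ℕ → ℕ → List Level → Set
LossBounded n d []                    = ⊤
LossBounded n d (level d′ B′ T ∷ lv) =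
  1 ≤ d′ × d′ ≤ B′ × suc (n * (d * d) + B′ ^ n) ≤ T * d′ ^ n × LossBounded n d′ lv

totalLoss : ℕ → ℕ → List Level → ℕ
totalLoss n d []                    = suc (n * (d * d))
totalLoss n d (level d′ B′ T ∷ lv) = totalLoss n d′ lv * T

record SphereFamily (n d : ℕ) (lv : List Level) : Set where
  field
    radii     : List ℕ
    radius    : ℕ
    points    : List (Vec ℕ n)
    unique    : Unique points
    bounded   : All (AllV (_< d)) points
    onSpheres : All (OnSpheres lv radii radius) points
    dense     : d ^ n ≤ totalLoss n d lv * length points

dense-spheres : ∀ n d lv → LossBounded n d lv → SphereFamily n d lv
dense-spheres n d [] _ = record
  { radii     = []
  ; radius    = R
  ; points    = G
  ; unique    = Unique.filter⁺ _ (box-unique n d)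
  ; bounded   = All.tabulate (λ v∈G → box-bounded n d (proj₁ (∈-fibre⁻ ‖_‖² (box n d) v∈G)))
  ; onSpheres = All.tabulate (λ v∈G → proj₂ (∈-fibre⁻ ‖_‖² (box n d) v∈G))
  ; dense     = subst (_≤ suc (n * (d * d)) * length G) (length-box n d) (proj₂ sphere)
  }
  where
  sphere = pigeonhole ‖_‖² (suc (n * (d * d))) (box n d)
             (All.tabulate λ v∈box → s≤s (‖‖²≤ d _ (box-bounded n d v∈box)))
  R = proj₁ sphere
  G = fibre ‖_‖² R (box n d)
dense-spheres n d (level d′ B′ T ∷ lv) (1≤d′ , d′≤B′ , M≤Td′ⁿ , loss) = record
  { radii     = S.radius ∷ radii
  ; radius    = radius
  ; points    = S.points
  ; unique    = S.unique
  ; bounded   = S.bounded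
  ; onSpheres = All.map (λ (w , w∈ , eq) → w , All.lookup bounded w∈ , eq , All.lookup onSpheres w∈) S.digits
  ; dense     = ℕ.*-cancelʳ-≤ (d ^ n) (K′ * T * length S.points) (d′ ^ n)
                  {{ℕ.m^n≢0 d′ n {{ℕ.>-nonZero 1≤d′}}}} count
  }
  where
  open SphereFamily (dense-spheres n d′ lv loss)
  module S = Shell (shell n d B′ points unique (All.map (AllV.map (λ x<d′ → ℕ.<-≤-trans x<d′ d′≤B′)) bounded))
  K′ = totalLoss n d′ lv
  count : d ^ n * d′ ^ n ≤ K′ * T * length S.points * d′ ^ n
  count = begin
    d ^ n * d′ ^ n                       ≤⟨ ℕ.*-monoʳ-≤ (d ^ n) dense ⟩
    d ^ n * (K′ * length points)         ≡⟨ swap (d ^ n) K′ (length points) ⟩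
    K′ * (d ^ n * length points)         ≤⟨ ℕ.*-monoʳ-≤ K′ S.dense ⟩
    K′ * (suc (n * (d * d) + B′ ^ n) * length S.points)
                                         ≤⟨ ℕ.*-monoʳ-≤ K′ (ℕ.*-monoˡ-≤ (length S.points) M≤Td′ⁿ) ⟩
    K′ * (T * d′ ^ n * length S.points)  ≡⟨ regroup K′ T (d′ ^ n) (length S.points) ⟩
    K′ * T * length S.points * d′ ^ n    ∎
    where
    open ℕ.≤-Reasoning
    swap : ∀ a k g → a * (k * g) ≡ k * (a * g)
    swap = ℕ-Solver.solve-∀
    regroup : ∀ k t e g → k * (t * e * g) ≡ k * t * g * e
    regroup = ℕ-Solver.solve-∀

∈-⋃⁅⁆⁻ : ∀ {N} (is : List (Fin N)) {i} → i ∈ ⋃ (map ⁅_⁆ is) → i ∈ₗ is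
∈-⋃⁅⁆⁻ []       i∈⊥ = ⊥-elim (∉⊥ i∈⊥)
∈-⋃⁅⁆⁻ (j ∷ is) i∈  with x∈p∪q⁻ ⁅ j ⁆ (⋃ (map ⁅_⁆ is)) i∈
... | inj₁ i∈⁅j⁆ = here (x∈⁅y⁆⇒x≡y j i∈⁅j⁆)
... | inj₂ i∈⋃   = there (∈-⋃⁅⁆⁻ is i∈⋃)

length≤∣⋃⁅⁆∣ : ∀ {N} (is : List (Fin N)) → Unique is → length is ≤ ∣ ⋃ (map ⁅_⁆ is) ∣
length≤∣⋃⁅⁆∣ []       _          = z≤n
length≤∣⋃⁅⁆∣ (i ∷ is) (i∉ ∷ uis) =
  ℕ.≤-trans (s≤s (length≤∣⋃⁅⁆∣ is uis)) (p⊂q⇒∣p∣<∣q∣ (q⊆p∪q _ _ , i , p⊆p∪q _ (x∈⁅x⁆ i) , i∉⋃))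
  where
  i∉⋃ : i ∈ ⋃ (map ⁅_⁆ is) → ⊥
  i∉⋃ i∈ = All.lookup i∉ (∈-⋃⁅⁆⁻ is i∈) refl

behrend-rankin : ∀ N n d B lv L → LossBounded n d lv → Admissible lv 1 L → 1 ≤ L →
                 2 * (d + d) < B → B ^ n ≤ N →
                 ∃ λ (A : Subset N) → APFree (suc L) A × d ^ n ≤ totalLoss n d lv * ∣ A ∣
behrend-rankin N n d B lv L loss adm 1≤L noCarry B^n≤N =
  A , apFree n d B lv radii radius L A encoded adm 1≤L noCarry , count
  where
  open SphereFamily (dense-spheres n d lv loss)
  instance
    N≢0 : ℕ.NonZero N
    N≢0 = ℕ.>-nonZero (ℕ.<-≤-trans (ℕ.m^n>0 B {{ℕ.>-nonZero (ℕ.≤-<-trans z≤n noCarry)}} n) B^n≤N)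
  value : Vec ℕ n → ℕ
  value = fromDigitsℕ B
  digits<B : ∀ {v} → v ∈ₗ points → AllV.All (_< B) v
  digits<B v∈ = AllV.map (λ x<d → ℕ.<-≤-trans x<d d≤B) (All.lookup bounded v∈)
    where
    d≤B : d ≤ B
    d≤B = ℕ.≤-trans (ℕ.m≤m+n d d) (ℕ.≤-trans (ℕ.m≤n*m (d + d) 2) (ℕ.<⇒≤ noCarry))
  value<N : ∀ {v} → v ∈ₗ points → value v < N
  value<N v∈ = ℕ.<-≤-trans (fromDigitsℕ<B^n B _ (digits<B v∈)) B^n≤N
  toℕ-value-mod : ∀ {v} → v ∈ₗ points → toℕ (value v DM.mod N) ≡ value v
  toℕ-value-mod v∈ = trans (Fin.toℕ-fromℕ< _) (DM.m<n⇒m%n≡m (value<N v∈))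
  is : List (Fin N)
  is = map (λ v → value v DM.mod N) points
  A : Subset N
  A = ⋃ (map ⁅_⁆ is)
  encoded : ∀ i → i ∈ A → Encoded n d B lv radii radius i
  encoded i i∈A with v , v∈ , refl ← ∈-map⁻ _ (∈-⋃⁅⁆⁻ is i∈A) =
    v , All.lookup bounded v∈ , toℕ-value-mod v∈ , All.lookup onSpheres v∈
  count : d ^ n ≤ totalLoss n d lv * ∣ A ∣
  count = begin
    d ^ n                           ≤⟨ dense ⟩
    totalLoss n d lv * length points ≡⟨ cong (totalLoss n d lv *_) (List.length-map _ points) ⟨
    totalLoss n d lv * length is     ≤⟨ ℕ.*-monoʳ-≤ (totalLoss n d lv) (length≤∣⋃⁅⁆∣ is unique-is) ⟩
    totalLoss n d lv * ∣ A ∣         ∎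
    where
    open ℕ.≤-Reasoning
    unique-is : Unique is
    unique-is = Unique-map⁺ _ (λ v∈ w∈ eq → fromDigitsℕ-injective B _ _ (digits<B v∈) (digits<B w∈)
                  (trans (sym (toℕ-value-mod v∈)) (trans (cong toℕ eq) (toℕ-value-mod w∈)))) unique

-- Choice of parameters

2^⌊log₂n⌋≤n : ∀ n → 1 ≤ n → 2 ^ ⌊log₂ n ⌋ ≤ n
2^⌊log₂n⌋≤n = <-rec (λ n → 1 ≤ n → 2 ^ ⌊log₂ n ⌋ ≤ n) bound
  where
  bound : ∀ n → (∀ {m} → m < n → 1 ≤ m → 2 ^ ⌊log₂ m ⌋ ≤ m) → 1 ≤ n → 2 ^ ⌊log₂ n ⌋ ≤ n
  bound (suc zero)    _   _ = s≤s z≤n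
  bound n@(suc (suc m)) rec _ = begin
    2 ^ ⌊log₂ n ⌋                 ≡⟨ cong (2 ^_) (ℕ.m+[n∸m]≡n (⌊log₂⌋-mono-≤ {2} {n} (s≤s (s≤s z≤n)))) ⟨
    2 * 2 ^ (⌊log₂ n ⌋ ∸ 1)       ≡⟨ cong (λ e → 2 * 2 ^ e) (⌊log₂⌊n/2⌋⌋≡⌊log₂n⌋∸1 n) ⟨
    2 * 2 ^ ⌊log₂ ⌊ n /2⌋ ⌋       ≤⟨ ℕ.*-monoʳ-≤ 2 (rec (ℕ.⌊n/2⌋<n (suc m)) (s≤s z≤n)) ⟩
    2 * ⌊ n /2⌋                   ≡⟨ cong (λ x → ⌊ n /2⌋ + x) (ℕ.+-identityʳ ⌊ n /2⌋) ⟩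
    ⌊ n /2⌋ + ⌊ n /2⌋             ≤⟨ ℕ.+-monoʳ-≤ ⌊ n /2⌋ (ℕ.⌊n/2⌋≤⌈n/2⌉ n) ⟩
    ⌊ n /2⌋ + ℕ.⌈ n /2⌉           ≡⟨ ℕ.⌊n/2⌋+⌈n/2⌉≡n n ⟩
    n                             ∎
    where open ℕ.≤-Reasoning

n<2^suc⌊log₂n⌋ : ∀ n → n < 2 ^ suc ⌊log₂ n ⌋
n<2^suc⌊log₂n⌋ n = ℕ.≰⇒> λ 2^[1+lg]≤n →
  ℕ.<-irrefl refl (subst (_≤ ⌊log₂ n ⌋) (⌊log₂[2^n]⌋≡n (suc ⌊log₂ n ⌋)) (⌊log₂⌋-mono-≤ 2^[1+lg]≤n))

first-crossing : (P : ℕ → Set) → (∀ m → Dec (P m)) → ¬ P 0 → ∀ b → P b → ∃ λ m → ¬ P m × P (suc m)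
first-crossing P P? ¬P0 zero    Pb = ⊥-elim (¬P0 Pb)
first-crossing P P? ¬P0 (suc b) Pb with P? b
... | yes Pb′ = first-crossing P P? ¬P0 b Pb′
... | no  ¬Pb = b , ¬Pb , Pb

2^-+ : ∀ a b → 2 ^ a * 2 ^ b ≡ 2 ^ (a + b)
2^-+ a b = sym (ℕ.^-distribˡ-+-* 2 a b)

n<2^n : ∀ n → n < 2 ^ n
n<2^n zero    = s≤s z≤n
n<2^n (suc n) = ℕ.+-mono-≤ (ℕ.m^n>0 2 n) (ℕ.≤-trans (n<2^n n) (ℕ.m≤m+n (2 ^ n) 0))

1+n*X≤2^n*X : ∀ n X → 1 ≤ X → suc (n * X) ≤ 2 ^ n * X
1+n*X≤2^n*X n X 1≤X = ℕ.≤-trans (ℕ.+-monoˡ-≤ (n * X) 1≤X) (ℕ.*-monoˡ-≤ X (n<2^n n))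

-- For d = 2ˣ, d′ = 2ʸ, B′ = 2ᶜ d′: n d² + 1 ≤ 2ⁿ d² ≤ B′ⁿ, so n d² + B′ⁿ + 1 ≤ 2 B′ⁿ.
loss-step : ∀ n c x y → n + (x + x) ≤ (c + y) * n →
            suc (n * (2 ^ x * 2 ^ x) + (2 ^ c * 2 ^ y) ^ n) ≤ 2 ^ suc (n * c) * (2 ^ y) ^ n
loss-step n c x y n+2x≤[c+y]n = begin
  suc (n * (2 ^ x * 2 ^ x) + (2 ^ c * 2 ^ y) ^ n)
    ≡⟨ cong₂ (λ a b → suc (n * a + b ^ n)) (2^-+ x x) (2^-+ c y) ⟩
  suc (n * 2 ^ (x + x)) + (2 ^ (c + y)) ^ n
    ≡⟨ cong (λ z → suc (n * 2 ^ (x + x)) + z) (ℕ.^-*-assoc 2 (c + y) n) ⟩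
  suc (n * 2 ^ (x + x)) + 2 ^ E
    ≤⟨ ℕ.+-monoˡ-≤ (2 ^ E) (1+n*X≤2^n*X n _ (ℕ.m^n>0 2 (x + x))) ⟩
  2 ^ n * 2 ^ (x + x) + 2 ^ E                      ≡⟨ cong (_+ 2 ^ E) (2^-+ n (x + x)) ⟩
  2 ^ (n + (x + x)) + 2 ^ E                        ≤⟨ ℕ.+-monoˡ-≤ (2 ^ E) (ℕ.^-monoʳ-≤ 2 n+2x≤[c+y]n) ⟩
  2 ^ E + 2 ^ E                                    ≡⟨ cong (λ z → 2 ^ E + z) (ℕ.+-identityʳ (2 ^ E)) ⟨
  2 ^ suc E                                        ≡⟨ cong (λ e → 2 ^ suc e) (distrib c y n) ⟩
  2 ^ (suc (n * c) + y * n)                        ≡⟨ 2^-+ (suc (n * c)) (y * n) ⟨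
  2 ^ suc (n * c) * 2 ^ (y * n)                    ≡⟨ cong (2 ^ suc (n * c) *_) (ℕ.^-*-assoc 2 y n) ⟨
  2 ^ suc (n * c) * (2 ^ y) ^ n                    ∎
  where
  open ℕ.≤-Reasoning
  E = (c + y) * n
  distrib : ∀ c y n → (c + y) * n ≡ n * c + y * n
  distrib = ℕ-Solver.solve-∀

-- Levels with digit exponents yᵢ = 2ⁱ t nʳ⁺¹⁻ⁱ, chosen so that 2 yᵢ = n yᵢ₊₁ exactly.
tower : ℕ → ℕ → ℕ → ℕ → List Level
tower n c t zero    = []
tower n c t (suc r) = level (2 ^ y) (2 ^ c * 2 ^ y) (2 ^ suc (n * c)) ∷ tower n c (2 * t) r
  where y = 2 * t * n ^ suc r

tower-loss : ∀ n c t r x → 1 ≤ c → x ≤ t * n ^ suc r →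
             LossBounded n (2 ^ x) (tower n c t r) ×
             totalLoss n (2 ^ x) (tower n c t r) ≤ 2 ^ (n + 2 ^ suc r * t * n + suc (n * c) * r)
tower-loss n c t zero x _ x≤tn = tt , (begin
  suc (n * (2 ^ x * 2 ^ x))       ≤⟨ 1+n*X≤2^n*X n _ (ℕ.*-mono-≤ (ℕ.m^n>0 2 x) (ℕ.m^n>0 2 x)) ⟩
  2 ^ n * (2 ^ x * 2 ^ x)         ≡⟨ trans (cong (2 ^ n *_) (2^-+ x x)) (2^-+ n (x + x)) ⟩
  2 ^ (n + (x + x))               ≤⟨ ℕ.^-monoʳ-≤ 2 n+2x≤n+2tn ⟩
  2 ^ (n + 2 * t * n + suc (n * c) * 0) ∎)
  where
  open ℕ.≤-Reasoning
  n+2x≤n+2tn : n + (x + x) ≤ n + 2 * t * n + suc (n * c) * 0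
  n+2x≤n+2tn = subst (n + (x + x) ≤_) (double n t (suc (n * c))) (ℕ.+-monoʳ-≤ n (ℕ.+-mono-≤ x≤tn x≤tn))
    where
    double : ∀ n t s → n + (t * (n * 1) + t * (n * 1)) ≡ n + 2 * t * n + s * 0
    double = ℕ-Solver.solve-∀
tower-loss n c t (suc r) x 1≤c x≤tn^[2+r] =
  (ℕ.m^n>0 2 y , ℕ.m≤n*m (2 ^ y) (2 ^ c) {{ℕ.m^n≢0 2 c}} , loss-step n c x y n+2x≤[c+y]n , proj₁ rest) ,
  (begin
    totalLoss n (2 ^ y) (tower n c (2 * t) r) * 2 ^ suc (n * c)
      ≤⟨ ℕ.*-monoˡ-≤ (2 ^ suc (n * c)) (proj₂ rest) ⟩
    2 ^ (n + 2 ^ suc r * (2 * t) * n + suc (n * c) * r) * 2 ^ suc (n * c)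
      ≡⟨ 2^-+ (n + 2 ^ suc r * (2 * t) * n + suc (n * c) * r) (suc (n * c)) ⟩
    2 ^ (n + 2 ^ suc r * (2 * t) * n + suc (n * c) * r + suc (n * c))
      ≡⟨ cong (2 ^_) (exponent n (2 ^ suc r) t (suc (n * c)) r) ⟩
    2 ^ (n + 2 ^ suc (suc r) * t * n + suc (n * c) * suc r) ∎)
  where
  open ℕ.≤-Reasoning
  y = 2 * t * n ^ suc r
  rest = tower-loss n c (2 * t) r y 1≤c ℕ.≤-refl
  n+2x≤[c+y]n : n + (x + x) ≤ (c + y) * n
  n+2x≤[c+y]n = ℕ.≤-trans (ℕ.+-mono-≤ (ℕ.m≤n*m n c {{ℕ.>-nonZero 1≤c}}) (ℕ.+-mono-≤ x≤tn^[2+r] x≤tn^[2+r]))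
                  (ℕ.≤-reflexive (regroup c t n (n ^ suc r)))
    where
    regroup : ∀ c t n p → c * n + (t * (n * p) + t * (n * p)) ≡ (c + 2 * t * p) * n
    regroup = ℕ-Solver.solve-∀
  exponent : ∀ n p t s r → n + p * (2 * t) * n + s * r + s ≡ n + 2 * p * t * n + s * suc r
  exponent = ℕ-Solver.solve-∀

no-carry : ∀ E L d → E ≤ L → 1 ≤ d → 2 ^ E * (d + d) < 2 ^ (2 + L) * d
no-carry E L d E≤L 1≤d = begin-strict
  2 ^ E * (d + d)      ≤⟨ ℕ.*-monoˡ-≤ (d + d) (ℕ.^-monoʳ-≤ 2 E≤L) ⟩
  2 ^ L * (d + d)      <⟨ ℕ.m<m+n (2 ^ L * (d + d)) (ℕ.*-mono-≤ (ℕ.m^n>0 2 L) (ℕ.≤-trans 1≤d (ℕ.m≤m+n d d))) ⟩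
  2 ^ L * (d + d) + 2 ^ L * (d + d) ≡⟨ rearrange (2 ^ L) d ⟩
  2 ^ (2 + L) * d      ∎
  where
  open ℕ.≤-Reasoning
  rearrange : ∀ p d → p * (d + d) + p * (d + d) ≡ 2 * (2 * p) * d
  rearrange = ℕ-Solver.solve-∀

tower-admissible : ∀ n L t r D → D * 2 ^ suc r ≤ L → Admissible (tower n (2 + L) t r) D L
tower-admissible n L t zero    D D*2≤L = subst (_≤ L) (double D) D*2≤L
  where
  double : ∀ D → D * 2 ≡ D + D
  double = ℕ-Solver.solve-∀
tower-admissible n L t (suc r) D D*2^[2+r]≤L =
  2D≤L , no-carry (D + D) L (2 ^ (2 * t * n ^ suc r)) 2D≤L (ℕ.m^n>0 2 (2 * t * n ^ suc r)) ,
  tower-admissible n L (2 * t) r (D + D) (subst (_≤ L) (regroup D (2 ^ suc r)) D*2^[2+r]≤L)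
  where
  regroup : ∀ D p → D * (2 * p) ≡ (D + D) * p
  regroup = ℕ-Solver.solve-∀
  2D≤L : D + D ≤ L
  2D≤L = ℕ.≤-trans (ℕ.≤-reflexive (trans (sym (ℕ.*-identityʳ (D + D))) (sym (regroup D 1))))
           (ℕ.≤-trans (ℕ.*-monoʳ-≤ D (ℕ.*-monoʳ-≤ 2 (ℕ.m^n>0 2 (suc r)))) D*2^[2+r]≤L)

*-^ : ∀ a b k → (a * b) ^ k ≡ a ^ k * b ^ k
*-^ a b zero    = refl
*-^ a b (suc k) = trans (cong (a * b *_) (*-^ a b k)) (swap a b (a ^ k) (b ^ k))
  where
  swap : ∀ a b x y → a * b * (x * y) ≡ a * x * (b * y)
  swap = ℕ-Solver.solve-∀

module Construction (k′ : ℕ) where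

  L K c C : ℕ
  L = 2 ^ suc k′
  K = suc (suc k′)
  c = 2 + L
  C = c + 2 + L + suc c * k′

  D₀ D₁ : ℕ
  D₀ = suc (suc c ^ K) ^ K
  D₁ = C ^ K * 2 ^ K

  Goal : ℕ → ℕ → Set
  Goal D N = ∃ λ (A : Subset N) → APFree (suc L) A × ∃ λ m → N ≤ 2 ^ m * ∣ A ∣ × m ^ K ≤ D * ⌊log₂ N ⌋

  1≤L : 1 ≤ L
  1≤L = ℕ.m^n>0 2 (suc k′)

  -- A single point (dimension 0) suffices when log N is bounded in terms of k.
  few-digits : ∀ N → 2 ≤ N → ⌊log₂ N ⌋ ≤ suc c ^ K → Goal D₀ N
  few-digits N 2≤N lg≤ = A , apf , suc lg , N≤2^m∣A∣ , m^K≤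
    where
    lg = ⌊log₂ N ⌋
    1≤lg : 1 ≤ lg
    1≤lg = ⌊log₂⌋-mono-≤ 2≤N
    point = behrend-rankin N 0 1 5 [] L tt (ℕ.*-monoʳ-≤ 2 (ℕ.m^n>0 2 k′)) 1≤L ℕ.≤-refl
              (ℕ.≤-trans (s≤s z≤n) 2≤N)
    A = proj₁ point
    apf = proj₁ (proj₂ point)
    1≤∣A∣ : 1 ≤ ∣ A ∣
    1≤∣A∣ = subst (1 ≤_) (ℕ.+-identityʳ ∣ A ∣) (proj₂ (proj₂ point))
    N≤2^m∣A∣ : N ≤ 2 ^ suc lg * ∣ A ∣
    N≤2^m∣A∣ = ℕ.≤-trans (ℕ.<⇒≤ (n<2^suc⌊log₂n⌋ N)) (ℕ.m≤m*n (2 ^ suc lg) ∣ A ∣ {{ℕ.>-nonZero 1≤∣A∣}})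
    m^K≤ : suc lg ^ K ≤ suc (suc c ^ K) ^ K * lg
    m^K≤ = ℕ.≤-trans (ℕ.^-monoˡ-≤ K (s≤s lg≤)) (ℕ.m≤m*n _ lg {{ℕ.>-nonZero 1≤lg}})

  -- With lg = ⌊log₂ N⌋ ≈ nᴷ: digits below d = 2ᵃ in base B = 2ᶜ d, where a = ⌊lg / n⌋ − c so
  -- that Bⁿ ≤ 2^lg; then N/|A| ≤ 2^(lg − a n) · totalLoss with both exponents O(n).
  many-digits : ∀ N n′ → 1 ≤ N → suc c ≤ n′ → n′ ^ K < ⌊log₂ N ⌋ → ⌊log₂ N ⌋ ≤ suc n′ ^ K →
                ∃ λ (A : Subset N) → APFree (suc L) A × ∃ λ m → N ≤ 2 ^ m * ∣ A ∣ × m ≤ C * suc n′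
  many-digits N n′ 1≤N c<n′ lo hi = A , apf , s + W , count , m≤Cn
    where
    n = suc n′
    lg = ⌊log₂ N ⌋
    q = lg / n
    a = q ∸ c
    d = 2 ^ a
    B = 2 ^ c * d
    c≤n′ : c ≤ n′
    c≤n′ = ℕ.<⇒≤ c<n′
    1≤n′ : 1 ≤ n′
    1≤n′ = ℕ.≤-trans (s≤s z≤n) c<n′
    cn≤lg : c * n ≤ lg
    cn≤lg = ℕ.<⇒≤ (ℕ.≤-<-trans (begin
      c * n         ≡⟨ ℕ.*-suc c n′ ⟩
      c + c * n′    ≤⟨ ℕ.+-monoˡ-≤ (c * n′) c≤n′ ⟩
      suc c * n′    ≤⟨ ℕ.*-monoˡ-≤ n′ c<n′ ⟩
      n′ * n′       ≤⟨ ℕ.*-monoʳ-≤ n′ (ℕ.m≤m*n n′ (n′ ^ k′) {{ℕ.m^n≢0 n′ k′ {{ℕ.>-nonZero 1≤n′}}}}) ⟩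
      n′ ^ K        ∎) lo)
      where open ℕ.≤-Reasoning
    c≤q : c ≤ q
    c≤q = subst (_≤ q) (DM.m*n/n≡m c n) (DM./-monoˡ-≤ n cn≤lg)
    c+a≡q : c + a ≡ q
    c+a≡q = ℕ.m+[n∸m]≡n c≤q
    a≤n^[1+k′] : a ≤ 1 * n ^ suc k′
    a≤n^[1+k′] = ℕ.≤-trans (ℕ.m∸n≤m q c) (subst (q ≤_) (sym (ℕ.*-identityˡ _)) q≤)
      where
      q≤ : q ≤ n ^ suc k′
      q≤ = subst (q ≤_) (DM.m*n/n≡m (n ^ suc k′) n)
             (DM./-monoˡ-≤ n (subst (lg ≤_) (ℕ.*-comm n (n ^ suc k′)) hi))
    lv = tower n c 1 k′
    loss = tower-loss n c 1 k′ a (s≤s z≤n) a≤n^[1+k′]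
    W = n + L * 1 * n + suc (n * c) * k′
    B^n≤N : B ^ n ≤ N
    B^n≤N = begin
      (2 ^ c * 2 ^ a) ^ n ≡⟨ cong (_^ n) (2^-+ c a) ⟩
      (2 ^ (c + a)) ^ n   ≡⟨ ℕ.^-*-assoc 2 (c + a) n ⟩
      2 ^ ((c + a) * n)   ≤⟨ ℕ.^-monoʳ-≤ 2 (subst (λ x → x * n ≤ lg) (sym c+a≡q) (DM.m/n*n≤m lg n)) ⟩
      2 ^ lg              ≤⟨ 2^⌊log₂n⌋≤n N 1≤N ⟩
      N                   ∎
      where open ℕ.≤-Reasoning
    construction = behrend-rankin N n d B lv L (proj₁ loss)
                     (tower-admissible n L 1 k′ 1 (ℕ.≤-reflexive (ℕ.*-identityˡ L)))
                     1≤L (no-carry 1 L d 1≤L (ℕ.m^n>0 2 a)) B^n≤N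
    A = proj₁ construction
    apf = proj₁ (proj₂ construction)
    s = suc lg ∸ a * n
    1+lg≤s+an : suc lg ≤ s + a * n
    1+lg≤s+an = subst (suc lg ≤_) (ℕ.+-comm (a * n) s) (ℕ.m≤n+m∸n (suc lg) (a * n))
    count : N ≤ 2 ^ (s + W) * ∣ A ∣
    count = begin
      N                                       ≤⟨ ℕ.<⇒≤ (n<2^suc⌊log₂n⌋ N) ⟩
      2 ^ suc lg                              ≤⟨ ℕ.^-monoʳ-≤ 2 1+lg≤s+an ⟩
      2 ^ (s + a * n)                         ≡⟨ 2^-+ s (a * n) ⟨
      2 ^ s * 2 ^ (a * n)                     ≡⟨ cong (2 ^ s *_) (ℕ.^-*-assoc 2 a n) ⟨
      2 ^ s * d ^ n                           ≤⟨ ℕ.*-monoʳ-≤ (2 ^ s) (proj₂ (proj₂ construction)) ⟩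
      2 ^ s * (totalLoss n d lv * ∣ A ∣)      ≤⟨ ℕ.*-monoʳ-≤ (2 ^ s) (ℕ.*-monoˡ-≤ ∣ A ∣ (proj₂ loss)) ⟩
      2 ^ s * (2 ^ W * ∣ A ∣)                 ≡⟨ ℕ.*-assoc (2 ^ s) (2 ^ W) ∣ A ∣ ⟨
      2 ^ s * 2 ^ W * ∣ A ∣                   ≡⟨ cong (_* ∣ A ∣) (2^-+ s W) ⟩
      2 ^ (s + W) * ∣ A ∣                     ∎
      where open ℕ.≤-Reasoning
    1+lg≤ : suc lg ≤ a * n + suc c * n
    1+lg≤ = begin
      suc lg                      ≡⟨ cong suc (DM.m≡m%n+[m/n]*n lg n) ⟩
      suc (lg % n) + q * n        ≤⟨ ℕ.+-monoˡ-≤ (q * n) (DM.m%n<n lg n) ⟩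
      n + q * n                   ≡⟨ cong (λ x → n + x * n) (sym c+a≡q) ⟩
      n + (c + a) * n             ≡⟨ regroup n c a ⟩
      a * n + suc c * n           ∎
      where
      open ℕ.≤-Reasoning
      regroup : ∀ n c a → n + (c + a) * n ≡ a * n + suc c * n
      regroup = ℕ-Solver.solve-∀
    m≤Cn : s + W ≤ C * n
    m≤Cn = begin
      s + W                                          ≤⟨ ℕ.+-mono-≤ (ℕ.m≤n+o⇒m∸n≤o (suc lg) (a * n) 1+lg≤) W≤ ⟩
      suc c * n + (n + L * 1 * n + (n + n * c) * k′) ≡⟨ regroup n c L k′ ⟩
      C * n                                          ∎
      where
      open ℕ.≤-Reasoning
      W≤ : W ≤ n + L * 1 * n + (n + n * c) * k′
      W≤ = ℕ.+-monoʳ-≤ (n + L * 1 * n) (ℕ.*-monoˡ-≤ k′ (ℕ.+-monoˡ-≤ (n * c) (s≤s (z≤n {n′}))))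
      regroup : ∀ n c L k → suc c * n + (n + L * 1 * n + (n + n * c) * k) ≡ (c + 2 + L + suc c * k) * n
      regroup = ℕ-Solver.solve-∀

  Goal-mono : ∀ {a b N} → a ≤ b → Goal a N → Goal b N
  Goal-mono a≤b (A , apf , m , count , m^K≤) = A , apf , m , count , ℕ.≤-trans m^K≤ (ℕ.*-monoˡ-≤ _ a≤b)

  ^K-bound : ∀ m n′ x → m ≤ C * suc n′ → 1 ≤ n′ → n′ ^ K < x → m ^ K ≤ C ^ K * 2 ^ K * x
  ^K-bound m n′ x m≤Cn 1≤n′ n′^K<x = begin
    m ^ K                      ≤⟨ ℕ.^-monoˡ-≤ K m≤Cn ⟩
    (C * suc n′) ^ K           ≡⟨ *-^ C (suc n′) K ⟩
    C ^ K * suc n′ ^ K         ≤⟨ ℕ.*-monoʳ-≤ (C ^ K) (ℕ.^-monoˡ-≤ K n≤2n′) ⟩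
    C ^ K * (2 * n′) ^ K       ≡⟨ cong (C ^ K *_) (*-^ 2 n′ K) ⟩
    C ^ K * (2 ^ K * n′ ^ K)   ≤⟨ ℕ.*-monoʳ-≤ (C ^ K) (ℕ.*-monoʳ-≤ (2 ^ K) (ℕ.<⇒≤ n′^K<x)) ⟩
    C ^ K * (2 ^ K * x)        ≡⟨ ℕ.*-assoc (C ^ K) (2 ^ K) x ⟨
    C ^ K * 2 ^ K * x          ∎
    where
    open ℕ.≤-Reasoning
    n≤2n′ : suc n′ ≤ 2 * n′
    n≤2n′ = ℕ.≤-trans (ℕ.+-monoˡ-≤ n′ 1≤n′) (ℕ.+-monoʳ-≤ n′ (ℕ.m≤m+n n′ 0))

  many-digits-goal : ∀ N n′ → 1 ≤ N → suc c ≤ n′ → n′ ^ K < ⌊log₂ N ⌋ → ⌊log₂ N ⌋ ≤ suc n′ ^ K →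
                     Goal D₁ N
  many-digits-goal N n′ 1≤N c<n′ lo hi = goal (many-digits N n′ 1≤N c<n′ lo hi)
    where
    goal : (∃ λ (A : Subset N) → APFree (suc L) A × ∃ λ m → N ≤ 2 ^ m * ∣ A ∣ × m ≤ C * suc n′) →
           Goal D₁ N
    goal (A , apf , m , count , m≤Cn) =
      A , apf , m , count , ^K-bound m n′ ⌊log₂ N ⌋ m≤Cn (ℕ.≤-trans (s≤s z≤n) c<n′) lo

  -- n′ + 1 = ⌈(log₂ N)^(1/K)⌉ is the dimension of the construction.
  root-bracket : ∀ N → 1 ≤ ⌊log₂ N ⌋ → ∃ λ n′ → ¬ ⌊log₂ N ⌋ ≤ n′ ^ K × ⌊log₂ N ⌋ ≤ suc n′ ^ K
  root-bracket N 1≤lg = first-crossing (λ m → ⌊log₂ N ⌋ ≤ m ^ K) (λ m → ⌊log₂ N ⌋ ≤? m ^ K)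
    (ℕ.<⇒≱ 1≤lg) ⌊log₂ N ⌋ (ℕ.m≤m*n ⌊log₂ N ⌋ _ {{ℕ.m^n≢0 _ (suc k′) {{ℕ.>-nonZero 1≤lg}}}})

  rankin-bound : ∀ N → 2 ≤ N → Goal (D₀ + D₁) N
  rankin-bound N 2≤N = by-size (root-bracket N (⌊log₂⌋-mono-≤ 2≤N))
    where
    by-size : (∃ λ n′ → ¬ ⌊log₂ N ⌋ ≤ n′ ^ K × ⌊log₂ N ⌋ ≤ suc n′ ^ K) → Goal (D₀ + D₁) N
    by-size (n′ , lo , hi) with suc c ≤? n′
    ... | yes c<n′ = Goal-mono (ℕ.m≤n+m D₁ D₀)
                       (many-digits-goal N n′ (ℕ.≤-trans (s≤s z≤n) 2≤N) c<n′ (ℕ.≰⇒> lo) hi)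
    ... | no  c≮n′ = Goal-mono (ℕ.m≤m+n D₀ D₁)
                       (few-digits N 2≤N (ℕ.≤-trans hi (ℕ.^-monoˡ-≤ K (s≤s (ℕ.≮⇒≥ c≮n′)))))

theorem1 : (k : ℕ) → 1 ≤ k →
    ∃ λ (D : ℕ) → (N : ℕ) → k < N →
      ∃ λ (A : Subset N) → APFree (1 + 2 ^ k) A ×
        ∃ λ (m : ℕ) → (N ≤ 2 ^ m * ∣ A ∣) × (m ^ suc k ≤ D * ⌊log₂ N ⌋)
theorem1 (suc k′) _ = D₀ + D₁ , λ N k<N → rankin-bound N (ℕ.≤-trans (s≤s (s≤s z≤n)) k<N)
  where open Construction k′
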